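{- Let $t$ and $u$ be $\lambda$-terms and $C,D$ contexts with $C\prec_p t$ and $D\prec_p t$. If $C\{x\leftarrow u\}\prec_{LO} D\{x\leftarrow u\}$ then $C\prec_{LO}D$.
   Context: $\lambda$-terms: $t::=x\mid\lambda x.t\mid tu$. Contexts on $\lambda$-terms: $C::=\langle\cdot\rangle\mid\lambda x.C\mid Ct\mid tC$. $C\prec_p t$ means $t=C\langle u\rangle$ for some $u$. $\{x\leftarrow u\}$ denotes ordinary (meta-level) substitution, extended to contexts by $\langle\cdot\rangle\{x\leftarrow u\}=\langle\cdot\rangle$ and homomorphically otherwise. Outside-in order: $\langle\cdot\rangle\prec_O C$ for every $C\neq\langle\cdot\rangle$, and $C\prec_O D$ implies $E\langle C\rangle\prec_O E\langle D\rangle$. Left-to-right order: if $C\prec_p t$ and $D\prec_p u$ then $Cu\prec_L tD$, and $C\prec_L D$ implies $E\langle C\rangle\prec_L E\langle D\rangle$. $C\prec_{LO}D$ iff $C\prec_O D$ or $C\prec_L D$. -}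

module Defs where

open import Data.Nat using (ℕ; zero; suc; _<ᵇ_; _≡ᵇ_)
open import Data.Bool using (if_then_else_)
open import Data.Product using (Σ; _,_)
open import Data.Sum using (_⊎_)
open import Relation.Binary.PropositionalEquality using (_≡_; _≢_)

-- λ-terms, with variables as de Bruijn indices (terms up to α-equivalence)
data Term : Set where
  var : ℕ → Term
  lam : Term → Term
  app : Term → Term → Term

data Ctx : Set where
  hole : Ctx
  lamC : Ctx → Ctx
  appL : Ctx → Term → Ctx
  appR : Term → Ctx → Ctx

-- plugging a term into a context (capture allowed, as usual for contexts)
plug : Ctx → Term → Term
plug hole t = t
plug (lamC C) t = lam (plug C t)
plug (appL C s) t = app (plug C t) s
plug (appR s C) t = app s (plug C t)

plugC : Ctx → Ctx → Ctx
plugC hole C = C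
plugC (lamC E) C = lamC (plugC E C)
plugC (appL E s) C = appL (plugC E C) s
plugC (appR s E) C = appR s (plugC E C)

_≺p_ : Ctx → Term → Set
C ≺p t = Σ Term (λ u → plug C u ≡ t)

shift : ℕ → Term → Term
shift c (var n) = if n <ᵇ c then var n else var (suc n)
shift c (lam t) = lam (shift (suc c) t)
shift c (app t s) = app (shift c t) (shift c s)

-- meta-level (capture-avoiding) substitution t{x←u}, x a de Bruijn index
sub : ℕ → Term → Term → Term
sub x u (var n) = if n ≡ᵇ x then u else var n
sub x u (lam t) = lam (sub (suc x) (shift 0 u) t)
sub x u (app t s) = app (sub x u t) (sub x u s)

subC : ℕ → Term → Ctx → Ctx
subC x u hole = hole
subC x u (lamC C) = lamC (subC (suc x) (shift 0 u) C)
subC x u (appL C s) = appL (subC x u C) (sub x u s)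
subC x u (appR s C) = appR (sub x u s) (subC x u C)

data _≺O_ : Ctx → Ctx → Set where
  O-hole : ∀ {C} → C ≢ hole → hole ≺O C
  O-ctx  : ∀ {C D} (E : Ctx) → C ≺O D → plugC E C ≺O plugC E D

data _≺L_ : Ctx → Ctx → Set where
  L-app : ∀ {C D t u} → C ≺p t → D ≺p u → appL C u ≺L appR t D
  L-ctx : ∀ {C D} (E : Ctx) → C ≺L D → plugC E C ≺L plugC E D

_≺LO_ : Ctx → Ctx → Set
C ≺LO D = (C ≺O D) ⊎ (C ≺L D)

-- Both orders are congruence closures of a base step, so they have syntax-directed
-- descriptions that descend through the contexts constructor by constructor.
-- Substitution keeps the outermost constructor of a context and sends only ⟨·⟩ to ⟨·⟩,
-- so such a derivation for C{x←u} and D{x←u} is also one for C and D, except that it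
-- only relates the substituted side terms.  Since C and D are prefixes of the same term t,
-- their side terms (and the terms filling the holes of the base ≺L step) already agree
-- in t itself.
module Submission where

open import Data.Nat using (ℕ)
open import Data.Product using (_×_; _,_)
open import Data.Sum using (inj₁; inj₂)
open import Relation.Binary.PropositionalEquality using (_≡_; _≢_; refl; sym; cong)
open import Defs

private
  variable
    C D : Ctx
    s s′ t : Term
    x : ℕ
    u : Term

lamC-≺p⁻¹ : lamC C ≺p lam t → C ≺p t
lamC-≺p⁻¹ (w , refl) = w , refl

appL-≺p⁻¹ : appL C s ≺p app t s′ → C ≺p t × s ≡ s′
appL-≺p⁻¹ (w , refl) = (w , refl) , refl

appR-≺p⁻¹ : appR s C ≺p app s′ t → s ≡ s′ × C ≺p t
appR-≺p⁻¹ (w , refl) = refl , (w , refl)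

infix 4 _≺O′_ _≺L′_

data _≺O′_ : Ctx → Ctx → Set where
  ≺O′-hole : D ≢ hole → hole ≺O′ D
  ≺O′-lamC : C ≺O′ D → lamC C ≺O′ lamC D
  ≺O′-appL : s ≡ s′ → C ≺O′ D → appL C s ≺O′ appL D s′
  ≺O′-appR : s ≡ s′ → C ≺O′ D → appR s C ≺O′ appR s′ D

data _≺L′_ : Ctx → Ctx → Set where
  ≺L′-app  : C ≺p t → D ≺p s → appL C s ≺L′ appR t D
  ≺L′-lamC : C ≺L′ D → lamC C ≺L′ lamC D
  ≺L′-appL : s ≡ s′ → C ≺L′ D → appL C s ≺L′ appL D s′
  ≺L′-appR : s ≡ s′ → C ≺L′ D → appR s C ≺L′ appR s′ D

plugC-≺O′ : ∀ E → C ≺O′ D → plugC E C ≺O′ plugC E D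
plugC-≺O′ hole       p = p
plugC-≺O′ (lamC E)   p = ≺O′-lamC (plugC-≺O′ E p)
plugC-≺O′ (appL E s) p = ≺O′-appL refl (plugC-≺O′ E p)
plugC-≺O′ (appR s E) p = ≺O′-appR refl (plugC-≺O′ E p)

plugC-≺L′ : ∀ E → C ≺L′ D → plugC E C ≺L′ plugC E D
plugC-≺L′ hole       p = p
plugC-≺L′ (lamC E)   p = ≺L′-lamC (plugC-≺L′ E p)
plugC-≺L′ (appL E s) p = ≺L′-appL refl (plugC-≺L′ E p)
plugC-≺L′ (appR s E) p = ≺L′-appR refl (plugC-≺L′ E p)

≺O⇒≺O′ : C ≺O D → C ≺O′ D
≺O⇒≺O′ (O-hole D≢hole) = ≺O′-hole D≢hole
≺O⇒≺O′ (O-ctx E p)     = plugC-≺O′ E (≺O⇒≺O′ p)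

≺O′⇒≺O : C ≺O′ D → C ≺O D
≺O′⇒≺O (≺O′-hole D≢hole)          = O-hole D≢hole
≺O′⇒≺O (≺O′-lamC p)               = O-ctx (lamC hole) (≺O′⇒≺O p)
≺O′⇒≺O (≺O′-appL {s = s} refl p)  = O-ctx (appL hole s) (≺O′⇒≺O p)
≺O′⇒≺O (≺O′-appR {s = s} refl p)  = O-ctx (appR s hole) (≺O′⇒≺O p)

≺L⇒≺L′ : C ≺L D → C ≺L′ D
≺L⇒≺L′ (L-app p q) = ≺L′-app p q
≺L⇒≺L′ (L-ctx E p) = plugC-≺L′ E (≺L⇒≺L′ p)

≺L′⇒≺L : C ≺L′ D → C ≺L D
≺L′⇒≺L (≺L′-app p q)              = L-app p q
≺L′⇒≺L (≺L′-lamC p)               = L-ctx (lamC hole) (≺L′⇒≺L p)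
≺L′⇒≺L (≺L′-appL {s = s} refl p)  = L-ctx (appL hole s) (≺L′⇒≺L p)
≺L′⇒≺L (≺L′-appR {s = s} refl p)  = L-ctx (appR s hole) (≺L′⇒≺L p)

subC-reflects-≺O′ : ∀ C D → C ≺p t → D ≺p t → subC x u C ≺O′ subC x u D → C ≺O′ D
subC-reflects-≺O′ hole D _ _ (≺O′-hole D[u]≢hole) =
  ≺O′-hole (λ D≡hole → D[u]≢hole (cong (subC _ _) D≡hole))
subC-reflects-≺O′ (lamC C) (lamC D) (w , refl) q (≺O′-lamC p) =
  ≺O′-lamC (subC-reflects-≺O′ C D (w , refl) (lamC-≺p⁻¹ q) p)
subC-reflects-≺O′ (appL C s) (appL D s′) (w , refl) q (≺O′-appL _ p) =
  let D≺ , s′≡s = appL-≺p⁻¹ q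
  in ≺O′-appL (sym s′≡s) (subC-reflects-≺O′ C D (w , refl) D≺ p)
subC-reflects-≺O′ (appR s C) (appR s′ D) (w , refl) q (≺O′-appR _ p) =
  let s′≡s , D≺ = appR-≺p⁻¹ q
  in ≺O′-appR (sym s′≡s) (subC-reflects-≺O′ C D (w , refl) D≺ p)
subC-reflects-≺O′ (lamC _)   hole       _ _ ()
subC-reflects-≺O′ (lamC _)   (appL _ _) _ _ ()
subC-reflects-≺O′ (lamC _)   (appR _ _) _ _ ()
subC-reflects-≺O′ (appL _ _) hole       _ _ ()
subC-reflects-≺O′ (appL _ _) (lamC _)   _ _ ()
subC-reflects-≺O′ (appL _ _) (appR _ _) _ _ ()
subC-reflects-≺O′ (appR _ _) hole       _ _ ()
subC-reflects-≺O′ (appR _ _) (lamC _)   _ _ ()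
subC-reflects-≺O′ (appR _ _) (appL _ _) _ _ ()

subC-reflects-≺L′ : ∀ C D → C ≺p t → D ≺p t → subC x u C ≺L′ subC x u D → C ≺L′ D
subC-reflects-≺L′ (appL C s) (appR s′ D) (w , refl) q (≺L′-app _ _) =
  let s′≡t , D≺ = appR-≺p⁻¹ q
  in ≺L′-app (w , sym s′≡t) D≺
subC-reflects-≺L′ (lamC C) (lamC D) (w , refl) q (≺L′-lamC p) =
  ≺L′-lamC (subC-reflects-≺L′ C D (w , refl) (lamC-≺p⁻¹ q) p)
subC-reflects-≺L′ (appL C s) (appL D s′) (w , refl) q (≺L′-appL _ p) =
  let D≺ , s′≡s = appL-≺p⁻¹ q
  in ≺L′-appL (sym s′≡s) (subC-reflects-≺L′ C D (w , refl) D≺ p)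
subC-reflects-≺L′ (appR s C) (appR s′ D) (w , refl) q (≺L′-appR _ p) =
  let s′≡s , D≺ = appR-≺p⁻¹ q
  in ≺L′-appR (sym s′≡s) (subC-reflects-≺L′ C D (w , refl) D≺ p)
subC-reflects-≺L′ hole       _          _ _ ()
subC-reflects-≺L′ (lamC _)   hole       _ _ ()
subC-reflects-≺L′ (lamC _)   (appL _ _) _ _ ()
subC-reflects-≺L′ (lamC _)   (appR _ _) _ _ ()
subC-reflects-≺L′ (appL _ _) hole       _ _ ()
subC-reflects-≺L′ (appL _ _) (lamC _)   _ _ ()
subC-reflects-≺L′ (appR _ _) hole       _ _ ()
subC-reflects-≺L′ (appR _ _) (lamC _)   _ _ ()
subC-reflects-≺L′ (appR _ _) (appL _ _) _ _ ()

mainTheorem17 : (t u : Term) (x : ℕ) (C D : Ctx) →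
    C ≺p t → D ≺p t → subC x u C ≺LO subC x u D → C ≺LO D
mainTheorem17 t u x C D p q (inj₁ o) =
  inj₁ (≺O′⇒≺O (subC-reflects-≺O′ C D p q (≺O⇒≺O′ o)))
mainTheorem17 t u x C D p q (inj₂ l) =
  inj₂ (≺L′⇒≺L (subC-reflects-≺L′ C D p q (≺L⇒≺L′ l)))
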